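{- Assume that for every finite poset $Q=(Y,\prec)$, every element $z\in Y$ and all integers $a,i\ge1$ the inequality \[ (a+i-1)\,\mathrm{N}(Q,z,a+i-1)\,\mathrm{N}(Q,z,a)\ \ge\ (a-1)\,\mathrm{N}(Q,z,a-1)\,\mathrm{N}(Q,z,a+i)\ +\ i\,\mathrm{N}(Q,z,a+i)\,\mathrm{N}(Q,z,a) \] holds. Let $P=(X,\prec)$ be a poset with $|X|=n$, let $x\in X$ and $a\in[n]$, and suppose $\mathrm{N}(P,x,a)>0$. Then \[ \mathrm{N}(P,x,a)^2=\mathrm{N}(P,x,a+1)\,\mathrm{N}(P,x,a-1)\iff \mathrm{N}(P,x,a+1)=\mathrm{N}(P,x,a)=\mathrm{N}(P,x,a-1), \] and moreover $\mathrm{N}(P,x,a)^2\ge \mathrm{N}(P,x,a+1)\,\mathrm{N}(P,x,a-1)$.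
   Context: For a finite poset $P=(X,\prec)$ with $|X|=n$, a linear extension is a bijection $f:X\to[n]$ with $f(u)<f(v)$ whenever $u\prec v$. For $z\in X$ and an integer $c$, $\mathrm{N}(P,z,c)$ denotes the number of linear extensions $f$ of $P$ with $f(z)=c$ (in particular it is $0$ when $c\notin[n]$). -}

module Defs where

open import Data.Nat using (ℕ; zero; suc; _+_; _<_)
open import Data.Fin using (Fin; toℕ)
import Data.Fin as F
open import Data.Fin.Properties using (all?; any?; _≟_)
open import Data.Vec using (Vec; []; _∷_; lookup)
open import Data.List using (List; []; _∷_; map; concatMap; filter; length)
open import Data.List.Base using (allFin)
import Data.Nat.Properties as ℕP
open import Data.Product using (Σ; ∃; _×_; _,_)
open import Relation.Binary.PropositionalEquality using (_≡_)
open import Relation.Nullary using (Dec; ¬_)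
open import Relation.Nullary.Decidable using (_×-dec_; _→-dec_)
open import Relation.Binary using (Decidable)

-- A finite poset on the ground set Fin n (any finite poset is isomorphic to one
-- of these), given by a decidable strict partial order _≺_.
record FinPoset (n : ℕ) : Set₁ where
  field
    _≺_     : Fin n → Fin n → Set
    ≺-dec   : Decidable _≺_
    irrefl  : ∀ u → ¬ (u ≺ u)
    trans   : ∀ {u v w} → u ≺ v → v ≺ w → u ≺ w

open FinPoset public

-- Positions are encoded as Fin n, the position toℕ i + 1 ∈ [n].
-- A linear extension: a bijection f : X → [n] with f u < f v whenever u ≺ v.
IsLinearExtension : ∀ {n} → FinPoset n → (Fin n → Fin n) → Set
IsLinearExtension {n} P f =
  ((u v : Fin n) → f u ≡ f v → u ≡ v)
  × ((y : Fin n) → ∃ λ x → f x ≡ y)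
  × ((u v : Fin n) → _≺_ P u v → toℕ (f u) < toℕ (f v))

isLinearExtension? : ∀ {n} (P : FinPoset n) (f : Fin n → Fin n) → Dec (IsLinearExtension P f)
isLinearExtension? {n} P f =
  all? (λ u → all? (λ v → (f u ≟ f v) →-dec (u ≟ v)))
  ×-dec all? (λ y → any? (λ x → f x ≟ y))
  ×-dec all? (λ u → all? (λ v → ≺-dec P u v →-dec (toℕ (f u) ℕP.<? toℕ (f v))))

allVecs : (n k : ℕ) → List (Vec (Fin n) k)
allVecs n zero    = [] ∷ []
allVecs n (suc k) = concatMap (λ i → map (i ∷_) (allVecs n k)) (allFin n)

-- N(P, z, c): number of linear extensions f of P with f(z) = c, positions in [n]
-- (so N P z 0 = 0 and N P z c = 0 for c > n).
N : ∀ {n} → FinPoset n → Fin n → ℕ → ℕ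
N {n} P z c =
  length (filter (λ v → isLinearExtension? P (lookup v)
                        ×-dec (suc (toℕ (lookup v z)) ℕP.≟ c))
                 (allVecs n n))

-- Applying the hypothesis with i = 1 to P at position a, and to the dual poset (whose
-- position c corresponds to position n + 1 − c of P), yields
--   (a−1)·N(a−1)·N(a+1) + N(a+1)·N(a) ≤ a·N(a)²   and
--   (n−a)·N(a+1)·N(a−1) + N(a−1)·N(a) ≤ (n−a+1)·N(a)².
-- If N(a)² ≤ N(a+1)·N(a−1), the first gives N(a+1) ≤ N(a) and the second N(a−1) ≤ N(a);
-- both the inequality and the equality case follow from these two bounds.
module Submission where

open import Defs renaming (trans to ≺-trans)
open import Data.Nat.Properties
open import Algebra.Properties.CommutativeMonoid.Sum +-0-commutativeMonoid
  using (sum; sum-cong-≋; sum-permute)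
open import Data.Bool using (true; false)
open import Data.Fin using (Fin; toℕ; opposite; zero; suc)
open import Data.Fin.Permutation using (Permutation; _⟨$⟩ʳ_; reverse)
open import Data.Fin.Properties using (opposite-prop; opposite-involutive; toℕ<n)
open import Data.List using (List; []; _∷_; _++_; map; concatMap; filter; length; tabulate)
open import Data.List.Properties using (filter-++; filter-≐; length-++)
open import Data.Nat using (ℕ; _≟_; zero; suc; _+_; _*_; _∸_; _≤_; _<_; _≥_; z≤n; s≤s; NonZero; >-nonZero)
open import Data.Nat.Tactic.RingSolver using (solve-∀)
open import Data.Product using (_×_; _,_; proj₁; proj₂)
open import Data.Sum using (inj₁; inj₂)
open import Data.Vec using (Vec; []; _∷_; lookup)
import Data.Vec as Vec
open import Data.Vec.Properties using (lookup-map)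
open import Function using (_∘_; id; _⇔_; mk⇔; Equivalence)
open import Relation.Binary.PropositionalEquality
open import Relation.Nullary using (Dec; does)
open import Relation.Nullary.Decidable using (_×-dec_)
open import Relation.Unary using (Pred; Decidable)

count : ∀ {a p} {A : Set a} {P : Pred A p} → Decidable P → List A → ℕ
count P? xs = length (filter P? xs)

module _ {a p} {A : Set a} {P : Pred A p} (P? : Decidable P) where

  count-++ : ∀ xs ys → count P? (xs ++ ys) ≡ count P? xs + count P? ys
  count-++ xs ys = trans (cong length (filter-++ P? xs ys)) (length-++ (filter P? xs))

  count-map : ∀ {b} {B : Set b} (h : B → A) xs → count P? (map h xs) ≡ count (P? ∘ h) xs
  count-map h []       = refl
  count-map h (x ∷ xs) with does (P? (h x))
  ... | true  = cong suc (count-map h xs)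
  ... | false = count-map h xs

  count-concatMap-tabulate : ∀ {b} {B : Set b} {n} (f : Fin n → B) (h : B → List A) →
    count P? (concatMap h (tabulate f)) ≡ sum (λ i → count P? (h (f i)))
  count-concatMap-tabulate {n = zero}  f h = refl
  count-concatMap-tabulate {n = suc n} f h =
    trans (count-++ (h (f zero)) _) (cong (count P? (h (f zero)) +_) (count-concatMap-tabulate (f ∘ suc) h))

count-allVecs-permute : ∀ {p} n k (π : Permutation n n) {P : Pred (Vec (Fin n) k) p} (P? : Decidable P) →
  count P? (allVecs n k) ≡ count (P? ∘ Vec.map (π ⟨$⟩ʳ_)) (allVecs n k)
count-allVecs-permute n zero    π P? =
  cong length (filter-≐ P? (P? ∘ Vec.map (π ⟨$⟩ʳ_)) ((λ { {[]} p → p }) , (λ { {[]} p → p })) ([] ∷ []))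
count-allVecs-permute n (suc k) π P? = begin
  count P? (allVecs n (suc k))                      ≡⟨ count-concatMap-tabulate P? id extend ⟩
  sum (λ i → count P? (extend i))                   ≡⟨ sum-cong-≋ (λ i → count-map P? (i ∷_) vs) ⟩
  sum (λ i → count (P? ∘ (i ∷_)) vs)                ≡⟨ sum-permute _ π ⟩
  sum (λ i → count (P? ∘ (σ i ∷_)) vs)              ≡⟨ sum-cong-≋ (λ i → count-allVecs-permute n k π (P? ∘ (σ i ∷_))) ⟩
  sum (λ i → count (Q? ∘ (i ∷_)) vs)                ≡⟨ sum-cong-≋ (λ i → count-map Q? (i ∷_) vs) ⟨
  sum (λ i → count Q? (extend i))                   ≡⟨ count-concatMap-tabulate Q? id extend ⟨
  count Q? (allVecs n (suc k))                      ∎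
  where
  open ≡-Reasoning
  σ = π ⟨$⟩ʳ_
  vs = allVecs n k
  extend = λ i → map (i ∷_) vs
  Q? = P? ∘ Vec.map σ

dual : ∀ {n} → FinPoset n → FinPoset n
dual P = record
  { _≺_    = λ u v → _≺_ P v u
  ; ≺-dec  = λ u v → ≺-dec P v u
  ; irrefl = irrefl P
  ; trans  = λ u≻v v≻w → ≺-trans P v≻w u≻v
  }

module _ {n} (P : FinPoset n) where

  isLinearExtension-≗ : ∀ {f g : Fin n → Fin n} → f ≗ g → IsLinearExtension P f → IsLinearExtension P g
  isLinearExtension-≗ {f} {g} f≗g (injective , surjective , monotone) =
    (λ u v gu≡gv → injective u v (trans (f≗g u) (trans gu≡gv (sym (f≗g v))))) ,
    (λ y → let (x , fx≡y) = surjective y in x , trans (sym (f≗g x)) fx≡y) ,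
    (λ u v u≺v → subst₂ _<_ (cong toℕ (f≗g u)) (cong toℕ (f≗g v)) (monotone u v u≺v))

toℕ-opposite-< : ∀ {n} {i j : Fin n} → toℕ i < toℕ j → toℕ (opposite j) < toℕ (opposite i)
toℕ-opposite-< {i = i} {j} i<j rewrite opposite-prop i | opposite-prop j = ∸-monoʳ-< (s≤s i<j) (toℕ<n j)

isLinearExtension-dual : ∀ {n} (P : FinPoset n) {f : Fin n → Fin n} →
  IsLinearExtension P f → IsLinearExtension (dual P) (opposite ∘ f)
isLinearExtension-dual P {f} (injective , surjective , monotone) =
  (λ u v eq → injective u v (opposite-injective eq)) ,
  (λ y → let (x , fx≡y) = surjective (opposite y) in x , trans (cong opposite fx≡y) (opposite-involutive y)) ,
  (λ u v v≺u → toℕ-opposite-< (monotone v u v≺u))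
  where
  opposite-injective : ∀ {i j} → opposite i ≡ opposite j → i ≡ j
  opposite-injective {i} {j} eq =
    trans (sym (opposite-involutive i)) (trans (cong opposite eq) (opposite-involutive j))

isLinearExtension-undual : ∀ {n} (P : FinPoset n) {f : Fin n → Fin n} →
  IsLinearExtension (dual P) (opposite ∘ f) → IsLinearExtension P f
isLinearExtension-undual P {f} =
  isLinearExtension-≗ P (opposite-involutive ∘ f) ∘ isLinearExtension-dual (dual P)

suc-toℕ-opposite : ∀ {n} (j : Fin n) → suc (toℕ j) + suc (toℕ (opposite j)) ≡ suc n
suc-toℕ-opposite {n} j = begin
  suc (toℕ j) + suc (toℕ (opposite j))  ≡⟨ cong (λ t → suc (toℕ j) + suc t) (opposite-prop j) ⟩
  suc (toℕ j) + suc (n ∸ suc (toℕ j))   ≡⟨ +-suc (suc (toℕ j)) _ ⟩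
  suc (suc (toℕ j) + (n ∸ suc (toℕ j))) ≡⟨ cong suc (m+[n∸m]≡n (toℕ<n j)) ⟩
  suc n                                 ∎
  where open ≡-Reasoning

position-opposite : ∀ {n} (j : Fin n) {c d} → d + c ≡ suc n →
  (suc (toℕ (opposite j)) ≡ c) ⇔ (suc (toℕ j) ≡ d)
position-opposite j {c} {d} d+c≡1+n = mk⇔
  (λ { refl → +-cancelʳ-≡ _ _ d (trans (suc-toℕ-opposite j) (sym d+c≡1+n)) })
  (λ { refl → +-cancelˡ-≡ d _ c (trans (suc-toℕ-opposite j) (sym d+c≡1+n)) })

N-dual : ∀ {n} (P : FinPoset n) (z : Fin n) {c d} → d + c ≡ suc n → N (dual P) z c ≡ N P z d
N-dual {n} P z {c} {d} d+c≡1+n = begin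
  count (linearExtensionAt? (dual P) c) (allVecs n n)
    ≡⟨ count-allVecs-permute n n reverse (linearExtensionAt? (dual P) c) ⟩
  count (linearExtensionAt? (dual P) c ∘ Vec.map opposite) (allVecs n n)
    ≡⟨ cong length (filter-≐ _ (linearExtensionAt? P d) ((λ {v} → to {v}) , (λ {v} → from {v})) (allVecs n n)) ⟩
  count (linearExtensionAt? P d) (allVecs n n) ∎
  where
  open ≡-Reasoning
  linearExtensionAt? : ∀ Q c (v : Vec (Fin n) n) → Dec (IsLinearExtension Q (lookup v) × suc (toℕ (lookup v z)) ≡ c)
  linearExtensionAt? Q c v = isLinearExtension? Q (lookup v) ×-dec (suc (toℕ (lookup v z)) ≟ c)
  to : ∀ {v} → IsLinearExtension (dual P) (lookup (Vec.map opposite v)) × suc (toℕ (lookup (Vec.map opposite v) z)) ≡ c →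
    IsLinearExtension P (lookup v) × suc (toℕ (lookup v z)) ≡ d
  to {v} (ext , at-c) =
    isLinearExtension-undual P (isLinearExtension-≗ (dual P) (λ i → lookup-map i opposite v) ext) ,
    Equivalence.to (position-opposite (lookup v z) d+c≡1+n) (subst (λ t → suc (toℕ t) ≡ c) (lookup-map z opposite v) at-c)
  from : ∀ {v} → IsLinearExtension P (lookup v) × suc (toℕ (lookup v z)) ≡ d →
    IsLinearExtension (dual P) (lookup (Vec.map opposite v)) × suc (toℕ (lookup (Vec.map opposite v) z)) ≡ c
  from {v} (ext , at-d) =
    isLinearExtension-≗ (dual P) (λ i → sym (lookup-map i opposite v)) (isLinearExtension-dual P ext) ,
    subst (λ t → suc (toℕ t) ≡ c) (sym (lookup-map z opposite v)) (Equivalence.from (position-opposite (lookup v z) d+c≡1+n) at-d)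

module _ {A B C : ℕ} .{{_ : NonZero A}} where

  ≤-of-square≤product : ∀ b → A * A ≤ B * C → b * C * B + 1 * B * A ≤ (b + 1) * A * A → B ≤ A
  ≤-of-square≤product b A²≤BC ineq = *-cancelʳ-≤ B A A (+-cancelˡ-≤ (b * (A * A)) (B * A) (A * A) (begin
    b * (A * A) + B * A  ≤⟨ +-monoˡ-≤ (B * A) (*-monoʳ-≤ b A²≤BC) ⟩
    b * (B * C) + B * A  ≡⟨ regroup b A B C ⟩
    b * C * B + 1 * B * A ≤⟨ ineq ⟩
    (b + 1) * A * A      ≡⟨ expand b A ⟩
    b * (A * A) + A * A  ∎))
    where
    open ≤-Reasoning
    regroup : ∀ b a u v → b * (u * v) + u * a ≡ b * v * u + 1 * u * a
    regroup = solve-∀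
    expand : ∀ b a → (b + 1) * a * a ≡ b * (a * a) + a * a
    expand = solve-∀

  square-vs-product : (A * A ≤ B * C → B ≤ A × C ≤ A) →
    ((A * A ≡ B * C) ⇔ (B ≡ A × A ≡ C)) × (B * C ≤ A * A)
  square-vs-product bounds = mk⇔ equal-terms (λ (B≡A , A≡C) → cong₂ _*_ (sym B≡A) A≡C) , product≤square
    where
    product≤square : B * C ≤ A * A
    product≤square with ≤-total (A * A) (B * C)
    ... | inj₁ A²≤BC = let (B≤A , C≤A) = bounds A²≤BC in *-mono-≤ B≤A C≤A
    ... | inj₂ BC≤A² = BC≤A²

    equal-terms : A * A ≡ B * C → B ≡ A × A ≡ C
    equal-terms A²≡BC = ≤-antisym B≤A A≤B , ≤-antisym A≤C C≤A
      where
      B≤A = proj₁ (bounds (≤-reflexive A²≡BC))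
      C≤A = proj₂ (bounds (≤-reflexive A²≡BC))
      A≤B = *-cancelʳ-≤ A B A (subst (_≤ B * A) (sym A²≡BC) (*-monoʳ-≤ B C≤A))
      A≤C = *-cancelˡ-≤ A (subst (_≤ A * C) (sym A²≡BC) (*-monoˡ-≤ C B≤A))

-- In the hypothesis at (a, i) = (k + 1, 1), N(k + 1) occurs both as N(a + i ∸ 1) and as N(a).
hypothesis-at-i≡1-cong : ∀ k {X Y Z W A B C : ℕ} → X ≡ A → Y ≡ A → Z ≡ B → W ≡ C →
  k * Z * W + 1 * W * Y ≤ (k + 1) * X * Y → k * B * C + 1 * C * A ≤ (k + 1) * A * A
hypothesis-at-i≡1-cong k refl refl refl refl ineq = ineq

proposition10p6 : ((m : ℕ) (Q : FinPoset m) (z : Fin m) (a i : ℕ) → 1 ≤ a → 1 ≤ i →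
    (a + i ∸ 1) * N Q z (a + i ∸ 1) * N Q z a
      ≥ (a ∸ 1) * N Q z (a ∸ 1) * N Q z (a + i) + i * N Q z (a + i) * N Q z a) →
  (n : ℕ) (P : FinPoset n) (x : Fin n) (a : ℕ) → 1 ≤ a → a ≤ n → 0 < N P x a →
    ((N P x a * N P x a ≡ N P x (a + 1) * N P x (a ∸ 1))
      ⇔ (N P x (a + 1) ≡ N P x a × N P x a ≡ N P x (a ∸ 1)))
    × (N P x a * N P x a ≥ N P x (a + 1) * N P x (a ∸ 1))
proposition10p6 hypothesis n P x (suc b) (s≤s z≤n) a≤n 0<N with m≤n⇒∃[o]m+o≡n a≤n
... | k , refl = square-vs-product (λ A²≤BC →
        ≤-of-square≤product b A²≤BC at-a ,
        ≤-of-square≤product k (≤-trans A²≤BC (≤-reflexive (*-comm B C))) at-opposite)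
  where
  A = N P x (suc b)
  B = N P x (suc b + 1)
  C = N P x b
  instance
    A≢0 : NonZero A
    A≢0 = >-nonZero 0<N
  at-a : b * C * B + 1 * B * A ≤ (b + 1) * A * A
  at-a = hypothesis-at-i≡1-cong b (cong (N P x) (+-comm b 1)) refl refl refl
    (hypothesis n P x (suc b) 1 (s≤s z≤n) (s≤s z≤n))
  at-opposite : k * B * C + 1 * C * A ≤ (k + 1) * A * A
  at-opposite = hypothesis-at-i≡1-cong k (N-dual P x (mirror₁ b k)) (N-dual P x (mirror₂ b k))
    (N-dual P x (mirror₃ b k)) (N-dual P x (mirror₄ b k))
    (hypothesis n (dual P) x (suc k) 1 (s≤s z≤n) (s≤s z≤n))
    where
    mirror₁ : ∀ b k → suc b + (k + 1) ≡ suc (suc b + k)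
    mirror₁ = solve-∀
    mirror₂ : ∀ b k → suc b + suc k ≡ suc (suc b + k)
    mirror₂ = solve-∀
    mirror₃ : ∀ b k → suc b + 1 + k ≡ suc (suc b + k)
    mirror₃ = solve-∀
    mirror₄ : ∀ b k → b + (suc k + 1) ≡ suc (suc b + k)
    mirror₄ = solve-∀
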